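{- For every prime $p>2$, $$\sum_{n=0}^{(p-3)/2}\frac{2^{ -2n}\binom{2n}n}{2n+1}\equiv-(-1)^{(p-1)/2}\,q_p(2)\pmod p.$$
   Context: $p$ denotes a prime. For a rational number $x$ whose numerator and denominator are not divisible by $p$, the Fermat quotient is $q_p(x)=(x^{p-1}-1)/p$. Congruences are understood in the ring of rational numbers whose denominators are not divisible by $p$. -}

module Defs where

open import Data.Nat as ℕ using (ℕ; zero; suc; _∸_; NonZero)
import Data.Nat.Properties as ℕP
open import Data.Nat.Divisibility using (_∣_)
open import Data.Nat.Combinatorics using (_C_)
open import Data.Integer as ℤ using (ℤ; +_; ∣_∣)
open import Data.Rational using (ℚ; 0ℚ; 1ℚ; _+_; _-_; _*_; _/_; ↥_; ↧ₙ_)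
open import Data.List using (List; foldr; map; upTo)
open import Data.Product using (_×_)
open import Relation.Nullary using (¬_)

_^ℚ_ : ℚ → ℕ → ℚ
x ^ℚ zero  = 1ℚ
x ^ℚ suc n = x * (x ^ℚ n)

fermatQuotient : (p : ℕ) → .{{_ : NonZero p}} → ℚ → ℚ
fermatQuotient p x = ((x ^ℚ (p ∸ 1)) - 1ℚ) * ((+ 1) / p)

-- x ≡ y (mod p) in the ring Z_(p) of rationals with denominator prime to p:
-- x - y = p * z with z ∈ Z_(p), i.e. (in lowest terms) p divides the numerator
-- of x - y and does not divide its denominator.
_≡_[modℚ_] : ℚ → ℚ → ℕ → Set
x ≡ y [modℚ p ] = (p ∣ ∣ ↥ (x - y) ∣) × ¬ (p ∣ ↧ₙ (x - y))

sumℚ : ℕ → (ℕ → ℚ) → ℚ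
sumℚ m f = foldr _+_ 0ℚ (map f (upTo m))

term : ℕ → ℚ
term n = (+ ((2 ℕ.* n) C n)) / ((4 ℕ.^ n) ℕ.* suc (2 ℕ.* n))
  where instance
    _ = ℕP.m^n≢0 4 n
    _ = ℕP.m*n≢0 (4 ℕ.^ n) (suc (2 ℕ.* n))

-- Write p = 2m + 1 and compute in the ring of rationals with denominator prime to p.
-- Both 4^-n C(2n,n) and (-1)^n C(m,n) satisfy a(n+1) (2n+2) = a(n) (2n+1) modulo p,
-- because 2n+1 ≡ 2n+1-p = -2(m-n); hence they are congruent for n ≤ m. Together with
-- 1/(2n+1) ≡ -1/(2(m-n)) and a reversal of the summation, the left-hand side becomes
-- (1/2) (-1)^m Σ_{i=1}^m (-1)^(i-1) C(m,i)/i = (1/2) (-1)^m H_m.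
-- On the other side 2^p = Σ_j C(p,j), where C(p,j+1) = p C(p-1,j)/(j+1) and C(p-1,j) ≡ (-1)^j,
-- so q_p(2) = (2^p - 2)/(2p) ≡ (1/2) Σ_{j<p-1} (-1)^j/(j+1), which the same reciprocal
-- congruence turns into -H_m/2.
module Submission where

open import Defs
open import Data.Nat using (ℕ; _∸_; _<_; NonZero)
open import Data.Nat.DivMod using (_/_)
open import Data.Nat.Primality using (Prime)
open import Data.Integer using (+_)
open import Data.Rational using (ℚ; -_; _*_; 1ℚ) renaming (_/_ to _/ℚ_)

import Data.Integer as ℤ
import Data.Integer.Properties as ℤ
import Data.Nat as ℕ
import Data.Nat.Properties as ℕ
import Data.Nat.Tactic.RingSolver as ℕSolver
import Data.Rational.Unnormalised as ℚᵘ
import Data.Rational.Unnormalised.Properties as ℚᵘ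
import Relation.Binary.Reasoning.Setoid as SetoidReasoning
import Tactic.RingSolver.Core.AlmostCommutativeRing as ACR
open import Data.Empty using (⊥-elim)
open import Data.Integer using (ℤ)
open import Data.List using (foldr; map; applyUpTo)
open import Data.Nat using (zero; suc)
open import Data.Nat.Combinatorics using (_C_; nCk+nC[k+1]≡[n+1]C[k+1]; k>n⇒nCk≡0; nCn≡1; nC1≡n; nCk≡nC[n∸k])
open import Data.Nat.Coprimality using (coprime-divisor; recompute) renaming (sym to coprime-sym)
open import Data.Nat.Divisibility using (_∣_; divides; ∣-trans; ∣1⇒≡1; ∣⇒≤)
open import Data.Nat.DivMod using (_%_; m*n/n≡m; m≡m%n+[m/n]*n; m%n<n)
open import Data.Nat.Primality using (euclidsLemma; ¬prime[1]; prime⇒irreducible)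
open import Data.Product using (_×_; _,_; ∃-syntax)
open import Data.Rational using (mkℚ; 0ℚ; ½; -½; _+_; _-_; ↥_; ↧_; ↧ₙ_; toℚᵘ)
open import Data.Rational.Properties
open import Data.Sum using (inj₁; inj₂)
open import Function using (_∘_)
open import Level using (0ℓ)
open import Relation.Binary.Bundles using (Setoid)
open import Relation.Binary.PropositionalEquality
open import Relation.Binary.Structures using (IsEquivalence)
open import Relation.Nullary using (¬_)
open import Relation.Nullary.Decidable using (dec⇒maybe)
open import Tactic.RingSolver using (solve-∀)

ℚ-ring : ACR.AlmostCommutativeRing 0ℓ 0ℓ
ℚ-ring = ACR.fromCommutativeRing +-*-commutativeRing (λ x → dec⇒maybe (0ℚ ≟ x))

-- Opaque because unfolding the gcd normalisation hidden in i / 1 defeats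
-- unification in the lemmas below.
opaque
  fromℤ : ℤ → ℚ
  fromℤ i = i /ℚ 1

  fromℤ-unfold : ∀ i → fromℤ i ≡ i /ℚ 1
  fromℤ-unfold i = refl

  fromℤ-0 : fromℤ (+ 0) ≡ 0ℚ
  fromℤ-0 = refl

  fromℤ-1 : fromℤ (+ 1) ≡ 1ℚ
  fromℤ-1 = refl

  toℚᵘ-fromℤ : ∀ i → toℚᵘ (fromℤ i) ℚᵘ.≃ ℚᵘ.mkℚᵘ i 0
  toℚᵘ-fromℤ i = toℚᵘ-fromℚᵘ (ℚᵘ.mkℚᵘ i 0)

fromℤ-homo-+ : ∀ i j → fromℤ (i ℤ.+ j) ≡ fromℤ i + fromℤ j
fromℤ-homo-+ i j = toℚᵘ-injective (begin
  toℚᵘ (fromℤ (i ℤ.+ j))                    ≈⟨ toℚᵘ-fromℤ (i ℤ.+ j) ⟩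
  ℚᵘ.mkℚᵘ (i ℤ.+ j) 0                        ≈⟨ ℚᵘ.*≡* (cong (ℤ._* ℤ.+ 1)
                                                   (sym (cong₂ ℤ._+_ (ℤ.*-identityʳ i) (ℤ.*-identityʳ j)))) ⟩
  ℚᵘ.mkℚᵘ i 0 ℚᵘ.+ ℚᵘ.mkℚᵘ j 0              ≈⟨ ℚᵘ.+-cong (toℚᵘ-fromℤ i) (toℚᵘ-fromℤ j) ⟨
  toℚᵘ (fromℤ i) ℚᵘ.+ toℚᵘ (fromℤ j)        ≈⟨ toℚᵘ-homo-+ (fromℤ i) (fromℤ j) ⟨
  toℚᵘ (fromℤ i + fromℤ j)                   ∎)
  where open ℚᵘ.≃-Reasoning

fromℤ-homo-* : ∀ i j → fromℤ (i ℤ.* j) ≡ fromℤ i * fromℤ j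
fromℤ-homo-* i j = toℚᵘ-injective (begin
  toℚᵘ (fromℤ (i ℤ.* j))                    ≈⟨ toℚᵘ-fromℤ (i ℤ.* j) ⟩
  ℚᵘ.mkℚᵘ (i ℤ.* j) 0                        ≈⟨ ℚᵘ.≃-refl ⟩
  ℚᵘ.mkℚᵘ i 0 ℚᵘ.* ℚᵘ.mkℚᵘ j 0              ≈⟨ ℚᵘ.*-cong (toℚᵘ-fromℤ i) (toℚᵘ-fromℤ j) ⟨
  toℚᵘ (fromℤ i) ℚᵘ.* toℚᵘ (fromℤ j)        ≈⟨ toℚᵘ-homo-* (fromℤ i) (fromℤ j) ⟨
  toℚᵘ (fromℤ i * fromℤ j)                   ∎)
  where open ℚᵘ.≃-Reasoning

fromℤ-homo‿- : ∀ i → fromℤ (ℤ.- i) ≡ - fromℤ i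
fromℤ-homo‿- i = toℚᵘ-injective (begin
  toℚᵘ (fromℤ (ℤ.- i))     ≈⟨ toℚᵘ-fromℤ (ℤ.- i) ⟩
  ℚᵘ.mkℚᵘ (ℤ.- i) 0         ≈⟨ ℚᵘ.-‿cong (toℚᵘ-fromℤ i) ⟨
  ℚᵘ.- toℚᵘ (fromℤ i)       ≈⟨ toℚᵘ-homo‿- (fromℤ i) ⟨
  toℚᵘ (- fromℤ i)          ∎)
  where open ℚᵘ.≃-Reasoning

fromℕ : ℕ → ℚ
fromℕ n = fromℤ (+ n)

fromℕ-homo-+ : ∀ m n → fromℕ (m ℕ.+ n) ≡ fromℕ m + fromℕ n
fromℕ-homo-+ m n = fromℤ-homo-+ (+ m) (+ n)

fromℕ-homo-* : ∀ m n → fromℕ (m ℕ.* n) ≡ fromℕ m * fromℕ n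
fromℕ-homo-* m n = trans (cong fromℤ (ℤ.pos-* m n)) (fromℤ-homo-* (+ m) (+ n))

fromℕ-suc : ∀ n → fromℕ (suc n) ≡ 1ℚ + fromℕ n
fromℕ-suc n = trans (fromℕ-homo-+ 1 n) (cong (_+ fromℕ n) fromℤ-1)

fromℕ-2n+1 : ∀ n → fromℕ (suc (2 ℕ.* n)) ≡ 1ℚ + fromℕ 2 * fromℕ n
fromℕ-2n+1 n = trans (fromℕ-suc (2 ℕ.* n)) (cong (_+_ 1ℚ) (fromℕ-homo-* 2 n))

fromℕ-homo-^ : ∀ a n → fromℕ a ^ℚ n ≡ fromℕ (a ℕ.^ n)
fromℕ-homo-^ a zero    = sym fromℤ-1
fromℕ-homo-^ a (suc n) = trans (cong (fromℕ a *_) (fromℕ-homo-^ a n)) (sym (fromℕ-homo-* a (a ℕ.^ n)))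

/-*-cancel : ∀ i d .{{_ : NonZero d}} → i /ℚ d * fromℕ d ≡ fromℤ i
/-*-cancel i d@(suc k) = toℚᵘ-injective (begin
  toℚᵘ (i /ℚ d * fromℕ d)                      ≈⟨ toℚᵘ-homo-* (i /ℚ d) (fromℕ d) ⟩
  toℚᵘ (i /ℚ d) ℚᵘ.* toℚᵘ (fromℕ d)            ≈⟨ ℚᵘ.*-cong (toℚᵘ-fromℚᵘ (ℚᵘ.mkℚᵘ i k))
                                                              (toℚᵘ-fromℤ (+ d)) ⟩
  ℚᵘ.mkℚᵘ i k ℚᵘ.* ℚᵘ.mkℚᵘ (+ d) 0            ≈⟨ ℚᵘ.*≡* (ℤ.*-assoc i (+ d) (+ 1)) ⟩
  ℚᵘ.mkℚᵘ i 0                                  ≈⟨ toℚᵘ-fromℤ i ⟨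
  toℚᵘ (fromℤ i)                               ∎)
  where open ℚᵘ.≃-Reasoning

-- Defined through _/_ so that ½ and the (+ 1) / p in fermatQuotient are instances by definition.
1/[1+_] : ℕ → ℚ
1/[1+ n ] = + 1 /ℚ suc n

1/[1+n]*[1+n]≡1 : ∀ n → 1/[1+ n ] * fromℕ (suc n) ≡ 1ℚ
1/[1+n]*[1+n]≡1 n = trans (/-*-cancel (+ 1) (suc n)) fromℤ-1

x*[1+d]≡y⇒x≡y*1/[1+d] : ∀ {x y} d → x * fromℕ (suc d) ≡ y → x ≡ y * 1/[1+ d ]
x*[1+d]≡y⇒x≡y*1/[1+d] {x} {y} d x[1+d]≡y = begin
  x                                  ≡⟨ *-identityʳ x ⟨
  x * 1ℚ                             ≡⟨ cong (x *_) (1/[1+n]*[1+n]≡1 d) ⟨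
  x * (1/[1+ d ] * fromℕ (suc d))    ≡⟨ x[yz]≡xzy x 1/[1+ d ] (fromℕ (suc d)) ⟩
  x * fromℕ (suc d) * 1/[1+ d ]      ≡⟨ cong (_* 1/[1+ d ]) x[1+d]≡y ⟩
  y * 1/[1+ d ]                      ∎
  where
  open ≡-Reasoning
  x[yz]≡xzy : ∀ a b c → a * (b * c) ≡ a * c * b
  x[yz]≡xzy = solve-∀ ℚ-ring

*-cancelʳ-fromℕ : ∀ {x y} d .{{_ : NonZero d}} → x * fromℕ d ≡ y * fromℕ d → x ≡ y
*-cancelʳ-fromℕ (suc d) xd≡yd = trans (x*[1+d]≡y⇒x≡y*1/[1+d] d xd≡yd) (sym (x*[1+d]≡y⇒x≡y*1/[1+d] d refl))

1/[1+2j+1]≡½*1/[1+j] : ∀ j → 1/[1+ suc (2 ℕ.* j) ] ≡ ½ * 1/[1+ j ]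
1/[1+2j+1]≡½*1/[1+j] j = begin
  1/[1+ suc (2 ℕ.* j) ]           ≡⟨ *-identityˡ _ ⟨
  1ℚ * 1/[1+ suc (2 ℕ.* j) ]      ≡⟨ x*[1+d]≡y⇒x≡y*1/[1+d] (suc (2 ℕ.* j)) ½*1/[1+j]*[2+2j]≡1 ⟨
  ½ * 1/[1+ j ]                   ∎
  where
  open ≡-Reasoning
  interchange : ∀ a b c d → a * b * (c * d) ≡ (a * c) * (b * d)
  interchange = solve-∀ ℚ-ring
  ½*1/[1+j]*[2+2j]≡1 : ½ * 1/[1+ j ] * fromℕ (suc (suc (2 ℕ.* j))) ≡ 1ℚ
  ½*1/[1+j]*[2+2j]≡1 = begin
    ½ * 1/[1+ j ] * fromℕ (suc (suc (2 ℕ.* j)))    ≡⟨ cong (λ k → ½ * 1/[1+ j ] * fromℕ k) (ℕ.*-suc 2 j) ⟨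
    ½ * 1/[1+ j ] * fromℕ (2 ℕ.* suc j)            ≡⟨ cong (½ * 1/[1+ j ] *_) (fromℕ-homo-* 2 (suc j)) ⟩
    ½ * 1/[1+ j ] * (fromℕ 2 * fromℕ (suc j))      ≡⟨ interchange ½ 1/[1+ j ] (fromℕ 2) (fromℕ (suc j)) ⟩
    (½ * fromℕ 2) * (1/[1+ j ] * fromℕ (suc j))    ≡⟨ cong₂ _*_ (1/[1+n]*[1+n]≡1 1) (1/[1+n]*[1+n]≡1 j) ⟩
    1ℚ                                             ∎

1/[1+a]+1/[1+b] : ∀ a b → 1/[1+ a ] + 1/[1+ b ] ≡ fromℕ (suc a ℕ.+ suc b) * (1/[1+ a ] * 1/[1+ b ])
1/[1+a]+1/[1+b] a b = sym (begin
  fromℕ (suc a ℕ.+ suc b) * (1/[1+ a ] * 1/[1+ b ])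
    ≡⟨ cong (_* (1/[1+ a ] * 1/[1+ b ])) (fromℕ-homo-+ (suc a) (suc b)) ⟩
  (fromℕ (suc a) + fromℕ (suc b)) * (1/[1+ a ] * 1/[1+ b ])
    ≡⟨ expand (fromℕ (suc a)) (fromℕ (suc b)) 1/[1+ a ] 1/[1+ b ] ⟩
  (1/[1+ a ] * fromℕ (suc a)) * 1/[1+ b ] + (1/[1+ b ] * fromℕ (suc b)) * 1/[1+ a ]
    ≡⟨ cong₂ (λ x y → x * 1/[1+ b ] + y * 1/[1+ a ]) (1/[1+n]*[1+n]≡1 a) (1/[1+n]*[1+n]≡1 b) ⟩
  1ℚ * 1/[1+ b ] + 1ℚ * 1/[1+ a ]
    ≡⟨ simplify 1/[1+ a ] 1/[1+ b ] ⟩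
  1/[1+ a ] + 1/[1+ b ]
    ∎)
  where
  open ≡-Reasoning
  expand : ∀ A B x y → (A + B) * (x * y) ≡ (x * A) * y + (y * B) * x
  expand = solve-∀ ℚ-ring
  simplify : ∀ x y → 1ℚ * y + 1ℚ * x ≡ x + y
  simplify = solve-∀ ℚ-ring

toℚᵘ-*-fromℕ : ∀ r b a → r * fromℕ b ≡ fromℤ a → toℚᵘ r ℚᵘ.* ℚᵘ.mkℚᵘ (+ b) 0 ℚᵘ.≃ ℚᵘ.mkℚᵘ a 0
toℚᵘ-*-fromℕ r b a rb≡a = begin
  toℚᵘ r ℚᵘ.* ℚᵘ.mkℚᵘ (+ b) 0    ≈⟨ ℚᵘ.*-congˡ {toℚᵘ r} (toℚᵘ-fromℤ (+ b)) ⟨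
  toℚᵘ r ℚᵘ.* toℚᵘ (fromℕ b)     ≈⟨ toℚᵘ-homo-* r (fromℕ b) ⟨
  toℚᵘ (r * fromℕ b)             ≡⟨ cong toℚᵘ rb≡a ⟩
  toℚᵘ (fromℤ a)                  ≈⟨ toℚᵘ-fromℤ a ⟩
  ℚᵘ.mkℚᵘ a 0                     ∎
  where open ℚᵘ.≃-Reasoning

r*b≡a⇒↥r*b≡a*↧r : ∀ r b a → r * fromℕ b ≡ fromℤ a → ↥ r ℤ.* + b ≡ a ℤ.* ↧ r
r*b≡a⇒↥r*b≡a*↧r r@(mkℚ n d _) b a rb≡a = begin
  n ℤ.* + b                ≡⟨ ℤ.*-identityʳ _ ⟨
  n ℤ.* + b ℤ.* + 1        ≡⟨ ℚᵘ.drop-*≡* (toℚᵘ-*-fromℕ r b a rb≡a) ⟩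
  a ℤ.* + (suc d ℕ.* 1)    ≡⟨ cong (λ k → a ℤ.* + k) (ℕ.*-identityʳ (suc d)) ⟩
  a ℤ.* + suc d            ∎
  where open ≡-Reasoning

∑ : ℕ → (ℕ → ℚ) → ℚ
∑ zero    f = 0ℚ
∑ (suc n) f = f 0 + ∑ n (f ∘ suc)

sum-map-applyUpTo : ∀ n (f : ℕ → ℚ) g → foldr _+_ 0ℚ (map f (applyUpTo g n)) ≡ ∑ n (f ∘ g)
sum-map-applyUpTo zero    f g = refl
sum-map-applyUpTo (suc n) f g = cong (_+_ (f (g 0))) (sum-map-applyUpTo n f (g ∘ suc))

sumℚ≡∑ : ∀ n f → sumℚ n f ≡ ∑ n f
sumℚ≡∑ n f = sum-map-applyUpTo n f (λ i → i)

∑-cong : ∀ n {f g} → (∀ i → i < n → f i ≡ g i) → ∑ n f ≡ ∑ n g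
∑-cong zero    f≡g = refl
∑-cong (suc n) f≡g = cong₂ _+_ (f≡g 0 (ℕ.s≤s ℕ.z≤n)) (∑-cong n (λ i i<n → f≡g (suc i) (ℕ.s≤s i<n)))

∑-+ : ∀ n f g → ∑ n (λ i → f i + g i) ≡ ∑ n f + ∑ n g
∑-+ zero    f g = sym (+-identityʳ 0ℚ)
∑-+ (suc n) f g = begin
  (f 0 + g 0) + ∑ n (λ i → f (suc i) + g (suc i))  ≡⟨ cong (_+_ (f 0 + g 0)) (∑-+ n (f ∘ suc) (g ∘ suc)) ⟩
  (f 0 + g 0) + (∑ n (f ∘ suc) + ∑ n (g ∘ suc))    ≡⟨ medial (f 0) (g 0) _ _ ⟩
  (f 0 + ∑ n (f ∘ suc)) + (g 0 + ∑ n (g ∘ suc))    ∎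
  where
  open ≡-Reasoning
  medial : ∀ a b c d → (a + b) + (c + d) ≡ (a + c) + (b + d)
  medial = solve-∀ ℚ-ring

∑-*ˡ : ∀ n c f → ∑ n (λ i → c * f i) ≡ c * ∑ n f
∑-*ˡ zero    c f = sym (*-zeroʳ c)
∑-*ˡ (suc n) c f = trans (cong (_+_ (c * f 0)) (∑-*ˡ n c (f ∘ suc))) (sym (*-distribˡ-+ c (f 0) _))

∑-snoc : ∀ n f → ∑ (suc n) f ≡ ∑ n f + f n
∑-snoc zero    f = trans (+-identityʳ (f 0)) (sym (+-identityˡ (f 0)))
∑-snoc (suc n) f = trans (cong (_+_ (f 0)) (∑-snoc n (f ∘ suc))) (sym (+-assoc (f 0) _ _))

∑-reverse : ∀ n f → ∑ n (λ i → f (n ∸ suc i)) ≡ ∑ n f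
∑-reverse zero    f = refl
∑-reverse (suc n) f = begin
  f n + ∑ n (λ i → f (n ∸ suc i))  ≡⟨ cong (_+_ (f n)) (∑-reverse n f) ⟩
  f n + ∑ n f                       ≡⟨ +-comm (f n) _ ⟩
  ∑ n f + f n                       ≡⟨ ∑-snoc n f ⟨
  ∑ (suc n) f                       ∎
  where open ≡-Reasoning

∑-pairs : ∀ n f → ∑ (2 ℕ.* n) f ≡ ∑ n (λ j → f (2 ℕ.* j) + f (suc (2 ℕ.* j)))
∑-pairs zero    f = refl
∑-pairs (suc n) f = begin
  ∑ (2 ℕ.* suc n) f
    ≡⟨ cong (λ k → ∑ k f) (ℕ.*-suc 2 n) ⟩
  f 0 + (f 1 + ∑ (2 ℕ.* n) (f ∘ suc ∘ suc))
    ≡⟨ +-assoc (f 0) (f 1) _ ⟨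
  (f 0 + f 1) + ∑ (2 ℕ.* n) (f ∘ suc ∘ suc)
    ≡⟨ cong (_+_ (f 0 + f 1)) (∑-pairs n (f ∘ suc ∘ suc)) ⟩
  (f 0 + f 1) + ∑ n (λ j → f (2 ℕ.+ 2 ℕ.* j) + f (3 ℕ.+ 2 ℕ.* j))
    ≡⟨ cong (_+_ (f 0 + f 1)) (∑-cong n (λ j _ →
         cong₂ (λ a b → f a + f b) (ℕ.*-suc 2 j) (cong suc (ℕ.*-suc 2 j)))) ⟨
  ∑ (suc n) (λ j → f (2 ℕ.* j) + f (suc (2 ℕ.* j)))
    ∎
  where open ≡-Reasoning

sign : ℕ → ℚ
sign n = (- 1ℚ) ^ℚ n

sign-suc : ∀ n → sign (suc n) ≡ - sign n
sign-suc n = -1*x≡-x (sign n)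
  where
  -1*x≡-x : ∀ x → (- 1ℚ) * x ≡ - x
  -1*x≡-x = solve-∀ ℚ-ring

sign-+ : ∀ m n → sign (m ℕ.+ n) ≡ sign m * sign n
sign-+ zero    n = sym (*-identityˡ (sign n))
sign-+ (suc m) n = trans (cong ((- 1ℚ) *_) (sign-+ m n)) (sym (*-assoc (- 1ℚ) (sign m) (sign n)))

sign*sign : ∀ n → sign n * sign n ≡ 1ℚ
sign*sign zero    = refl
sign*sign (suc n) = trans ([-x][-x]≡xx (sign n)) (sign*sign n)
  where
  [-x][-x]≡xx : ∀ x → ((- 1ℚ) * x) * ((- 1ℚ) * x) ≡ x * x
  [-x][-x]≡xx = solve-∀ ℚ-ring

sign-even : ∀ n → sign (2 ℕ.* n) ≡ 1ℚ
sign-even n = begin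
  sign (n ℕ.+ (n ℕ.+ 0))  ≡⟨ cong (λ k → sign (n ℕ.+ k)) (ℕ.+-identityʳ n) ⟩
  sign (n ℕ.+ n)          ≡⟨ sign-+ n n ⟩
  sign n * sign n         ≡⟨ sign*sign n ⟩
  1ℚ                      ∎
  where open ≡-Reasoning

sign-∸ : ∀ {n i} → i ℕ.≤ n → sign (n ∸ i) ≡ sign n * sign i
sign-∸ {n} {i} i≤n = begin
  sign (n ∸ i)                    ≡⟨ *-identityʳ _ ⟨
  sign (n ∸ i) * 1ℚ               ≡⟨ cong (sign (n ∸ i) *_) (sign*sign i) ⟨
  sign (n ∸ i) * (sign i * sign i) ≡⟨ *-assoc (sign (n ∸ i)) (sign i) (sign i) ⟨
  sign (n ∸ i) * sign i * sign i  ≡⟨ cong (_* sign i) (sign-+ (n ∸ i) i) ⟨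
  sign (n ∸ i ℕ.+ i) * sign i     ≡⟨ cong (λ k → sign k * sign i) (ℕ.m∸n+n≡m i≤n) ⟩
  sign n * sign i                 ∎
  where open ≡-Reasoning

[1+n]C[1+k]*[1+k]≡[1+n]*nCk : ∀ n k → (suc n C suc k) ℕ.* suc k ≡ suc n ℕ.* (n C k)
[1+n]C[1+k]*[1+k]≡[1+n]*nCk zero    zero    = refl
[1+n]C[1+k]*[1+k]≡[1+n]*nCk zero    (suc k) = refl
[1+n]C[1+k]*[1+k]≡[1+n]*nCk (suc n) zero    = cong (ℕ._* 1) (nC1≡n (suc (suc n)))
[1+n]C[1+k]*[1+k]≡[1+n]*nCk (suc n) (suc k) = begin
  (suc (suc n) C suc (suc k)) ℕ.* suc (suc k)
    ≡⟨ cong (ℕ._* suc (suc k)) (nCk+nC[k+1]≡[n+1]C[k+1] (suc n) (suc k)) ⟨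
  (suc n C suc k ℕ.+ suc n C suc (suc k)) ℕ.* suc (suc k)
    ≡⟨ expand (suc n C suc k) (suc n C suc (suc k)) k ⟩
  (suc n C suc k) ℕ.* suc k ℕ.+ suc n C suc k ℕ.+ (suc n C suc (suc k)) ℕ.* suc (suc k)
    ≡⟨ cong₂ (λ a b → a ℕ.+ suc n C suc k ℕ.+ b)
         ([1+n]C[1+k]*[1+k]≡[1+n]*nCk n k) ([1+n]C[1+k]*[1+k]≡[1+n]*nCk n (suc k)) ⟩
  suc n ℕ.* (n C k) ℕ.+ suc n C suc k ℕ.+ suc n ℕ.* (n C suc k)
    ≡⟨ collect n (n C k) (n C suc k) (suc n C suc k) ⟩
  suc n ℕ.* (n C k ℕ.+ n C suc k) ℕ.+ suc n C suc k
    ≡⟨ cong (λ c → suc n ℕ.* c ℕ.+ suc n C suc k) (nCk+nC[k+1]≡[n+1]C[k+1] n k) ⟩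
  suc n ℕ.* (suc n C suc k) ℕ.+ suc n C suc k
    ≡⟨ ℕ.+-comm (suc n ℕ.* (suc n C suc k)) _ ⟩
  suc (suc n) ℕ.* (suc n C suc k)
    ∎
  where
  open ≡-Reasoning
  expand : ∀ a b k → (a ℕ.+ b) ℕ.* suc (suc k) ≡ a ℕ.* suc k ℕ.+ a ℕ.+ b ℕ.* suc (suc k)
  expand = ℕSolver.solve-∀
  collect : ∀ n a b c → suc n ℕ.* a ℕ.+ c ℕ.+ suc n ℕ.* b ≡ suc n ℕ.* (a ℕ.+ b) ℕ.+ c
  collect = ℕSolver.solve-∀

central-binomial-rec : ∀ n → ((2 ℕ.* suc n) C suc n) ℕ.* suc n ≡ 2 ℕ.* suc (2 ℕ.* n) ℕ.* ((2 ℕ.* n) C n)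
central-binomial-rec n = ℕ.*-cancelʳ-≡ _ _ (suc n) (begin
  ((2 ℕ.* suc n) C suc n) ℕ.* suc n ℕ.* suc n
    ≡⟨ cong (λ k → (k C suc n) ℕ.* suc n ℕ.* suc n) (ℕ.*-suc 2 n) ⟩
  (suc (suc (2 ℕ.* n)) C suc n) ℕ.* suc n ℕ.* suc n
    ≡⟨ cong (ℕ._* suc n) ([1+n]C[1+k]*[1+k]≡[1+n]*nCk (suc (2 ℕ.* n)) n) ⟩
  suc (suc (2 ℕ.* n)) ℕ.* (suc (2 ℕ.* n) C n) ℕ.* suc n
    ≡⟨ cong (λ c → suc (suc (2 ℕ.* n)) ℕ.* c ℕ.* suc n) symmetry ⟩
  suc (suc (2 ℕ.* n)) ℕ.* (suc (2 ℕ.* n) C suc n) ℕ.* suc n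
    ≡⟨ ℕ.*-assoc (suc (suc (2 ℕ.* n))) (suc (2 ℕ.* n) C suc n) (suc n) ⟩
  suc (suc (2 ℕ.* n)) ℕ.* ((suc (2 ℕ.* n) C suc n) ℕ.* suc n)
    ≡⟨ cong (suc (suc (2 ℕ.* n)) ℕ.*_) ([1+n]C[1+k]*[1+k]≡[1+n]*nCk (2 ℕ.* n) n) ⟩
  suc (suc (2 ℕ.* n)) ℕ.* (suc (2 ℕ.* n) ℕ.* ((2 ℕ.* n) C n))
    ≡⟨ regroup n ((2 ℕ.* n) C n) ⟩
  2 ℕ.* suc (2 ℕ.* n) ℕ.* ((2 ℕ.* n) C n) ℕ.* suc n
    ∎)
  where
  open ≡-Reasoning
  symmetry : suc (2 ℕ.* n) C n ≡ suc (2 ℕ.* n) C suc n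
  symmetry = begin
    suc (2 ℕ.* n) C n                       ≡⟨ nCk≡nC[n∸k] (ℕ.≤-trans (ℕ.m≤m+n n (n ℕ.+ 0)) (ℕ.n≤1+n _)) ⟩
    suc (2 ℕ.* n) C (suc (2 ℕ.* n) ∸ n)     ≡⟨ cong (λ k → suc (2 ℕ.* n) C (k ∸ n)) (two-halves n) ⟩
    suc (2 ℕ.* n) C (n ℕ.+ suc n ∸ n)       ≡⟨ cong (suc (2 ℕ.* n) C_) (ℕ.m+n∸m≡n n (suc n)) ⟩
    suc (2 ℕ.* n) C suc n                   ∎
    where
    two-halves : ∀ n → suc (2 ℕ.* n) ≡ n ℕ.+ suc n
    two-halves = ℕSolver.solve-∀
  regroup : ∀ n c → suc (suc (2 ℕ.* n)) ℕ.* (suc (2 ℕ.* n) ℕ.* c) ≡ 2 ℕ.* suc (2 ℕ.* n) ℕ.* c ℕ.* suc n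
  regroup = ℕSolver.solve-∀

binomial : ℕ → ℕ → ℚ
binomial n k = fromℕ (n C k)

binomial-0 : ∀ n → binomial n 0 ≡ 1ℚ
binomial-0 n = fromℤ-1

binomial-diag : ∀ n → binomial n n ≡ 1ℚ
binomial-diag n = trans (cong fromℕ (nCn≡1 n)) fromℤ-1

binomial-suc : ∀ n → binomial n (suc n) ≡ 0ℚ
binomial-suc n = trans (cong fromℕ (k>n⇒nCk≡0 (ℕ.n<1+n n))) fromℤ-0

binomial-pascal : ∀ n k → binomial (suc n) (suc k) ≡ binomial n k + binomial n (suc k)
binomial-pascal n k = trans (cong fromℕ (sym (nCk+nC[k+1]≡[n+1]C[k+1] n k))) (fromℕ-homo-+ _ _)

binomial-absorption : ∀ n k → binomial (suc n) (suc k) * fromℕ (suc k) ≡ fromℕ (suc n) * binomial n k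
binomial-absorption n k = begin
  binomial (suc n) (suc k) * fromℕ (suc k)  ≡⟨ fromℕ-homo-* _ _ ⟨
  fromℕ ((suc n C suc k) ℕ.* suc k)           ≡⟨ cong fromℕ ([1+n]C[1+k]*[1+k]≡[1+n]*nCk n k) ⟩
  fromℕ (suc n ℕ.* (n C k))                 ≡⟨ fromℕ-homo-* _ _ ⟩
  fromℕ (suc n) * binomial n k              ∎
  where open ≡-Reasoning

binomial-suc-suc : ∀ n k → binomial (suc n) (suc k) ≡ fromℕ (suc n) * binomial n k * 1/[1+ k ]
binomial-suc-suc n k = x*[1+d]≡y⇒x≡y*1/[1+d] k (binomial-absorption n k)

binomial-absorption⁻¹ : ∀ m n → binomial m n * 1/[1+ n ] ≡ 1/[1+ m ] * binomial (suc m) (suc n)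
binomial-absorption⁻¹ m n = begin
  binomial m n * 1/[1+ n ]                                  ≡⟨ *-identityˡ _ ⟨
  1ℚ * (binomial m n * 1/[1+ n ])                           ≡⟨ cong (_* (binomial m n * 1/[1+ n ])) (1/[1+n]*[1+n]≡1 m) ⟨
  1/[1+ m ] * fromℕ (suc m) * (binomial m n * 1/[1+ n ])    ≡⟨ reassoc 1/[1+ m ] (fromℕ (suc m)) (binomial m n) 1/[1+ n ] ⟩
  1/[1+ m ] * (fromℕ (suc m) * binomial m n * 1/[1+ n ])    ≡⟨ cong (1/[1+ m ] *_) (binomial-suc-suc m n) ⟨
  1/[1+ m ] * binomial (suc m) (suc n)                      ∎
  where
  open ≡-Reasoning
  reassoc : ∀ a b c d → a * b * (c * d) ≡ a * (b * c * d)
  reassoc = solve-∀ ℚ-ring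

binomial-ratio : ∀ m n → binomial m (suc n) * fromℕ (suc n) ≡ binomial m n * (fromℕ m - fromℕ n)
binomial-ratio m n = begin
  binomial m (suc n) * fromℕ (suc n)
    ≡⟨ split (binomial m n) (binomial m (suc n)) (fromℕ (suc n)) ⟩
  (binomial m n + binomial m (suc n)) * fromℕ (suc n) - binomial m n * fromℕ (suc n)
    ≡⟨ cong (λ c → c * fromℕ (suc n) - binomial m n * fromℕ (suc n)) (binomial-pascal m n) ⟨
  binomial (suc m) (suc n) * fromℕ (suc n) - binomial m n * fromℕ (suc n)
    ≡⟨ cong₂ (λ a b → a - binomial m n * b) (binomial-absorption m n) (fromℕ-suc n) ⟩
  fromℕ (suc m) * binomial m n - binomial m n * (1ℚ + fromℕ n)
    ≡⟨ cong (λ a → a * binomial m n - binomial m n * (1ℚ + fromℕ n)) (fromℕ-suc m) ⟩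
  (1ℚ + fromℕ m) * binomial m n - binomial m n * (1ℚ + fromℕ n)
    ≡⟨ collect (binomial m n) (fromℕ m) (fromℕ n) ⟩
  binomial m n * (fromℕ m - fromℕ n)
    ∎
  where
  open ≡-Reasoning
  split : ∀ a b x → b * x ≡ (a + b) * x - a * x
  split = solve-∀ ℚ-ring
  collect : ∀ c x y → (1ℚ + x) * c - c * (1ℚ + y) ≡ c * (x - y)
  collect = solve-∀ ℚ-ring

binomial-row-sum : ∀ N → ∑ (suc N) (binomial N) ≡ fromℕ (2 ℕ.^ N)
binomial-row-sum zero    = +-identityʳ (binomial 0 0)
binomial-row-sum (suc N) = begin
  binomial (suc N) 0 + ∑ (suc N) (λ k → binomial (suc N) (suc k))
    ≡⟨ cong₂ _+_ (binomial-0 (suc N)) (∑-cong (suc N) (λ k _ → binomial-pascal N k)) ⟩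
  1ℚ + ∑ (suc N) (λ k → binomial N k + binomial N (suc k))
    ≡⟨ cong (_+_ 1ℚ) (∑-+ (suc N) (binomial N) (λ k → binomial N (suc k))) ⟩
  1ℚ + (∑ (suc N) (binomial N) + ∑ (suc N) (λ k → binomial N (suc k)))
    ≡⟨ cong (λ s → 1ℚ + (∑ (suc N) (binomial N) + s)) (∑-snoc N (λ k → binomial N (suc k))) ⟩
  1ℚ + (∑ (suc N) (binomial N) + (∑ N (λ k → binomial N (suc k)) + binomial N (suc N)))
    ≡⟨ cong (λ c → 1ℚ + (∑ (suc N) (binomial N) + (∑ N (λ k → binomial N (suc k)) + c))) (binomial-suc N) ⟩
  1ℚ + (∑ (suc N) (binomial N) + (∑ N (λ k → binomial N (suc k)) + 0ℚ))
    ≡⟨ regroup (∑ (suc N) (binomial N)) (∑ N (λ k → binomial N (suc k))) ⟩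
  ∑ (suc N) (binomial N) + (1ℚ + ∑ N (λ k → binomial N (suc k)))
    ≡⟨ cong (λ b → ∑ (suc N) (binomial N) + (b + ∑ N (λ k → binomial N (suc k)))) (binomial-0 N) ⟨
  ∑ (suc N) (binomial N) + ∑ (suc N) (binomial N)
    ≡⟨ cong₂ _+_ (binomial-row-sum N) (binomial-row-sum N) ⟩
  fromℕ (2 ℕ.^ N) + fromℕ (2 ℕ.^ N)
    ≡⟨ fromℕ-homo-+ (2 ℕ.^ N) (2 ℕ.^ N) ⟨
  fromℕ (2 ℕ.^ N ℕ.+ 2 ℕ.^ N)
    ≡⟨ cong (λ k → fromℕ (2 ℕ.^ N ℕ.+ k)) (ℕ.+-identityʳ (2 ℕ.^ N)) ⟨
  fromℕ (2 ℕ.^ suc N)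
    ∎
  where
  open ≡-Reasoning
  regroup : ∀ r t → 1ℚ + (r + (t + 0ℚ)) ≡ r + (1ℚ + t)
  regroup = solve-∀ ℚ-ring

alternating-binomial-sum : ∀ N → ∑ (suc N) (λ n → sign n * binomial (suc N) (suc n)) ≡ 1ℚ
alternating-binomial-sum N = begin
  ∑ (suc N) (λ n → sign n * binomial (suc N) (suc n))
    ≡⟨ ∑-cong (suc N) (λ n _ → trans (cong (sign n *_) (binomial-pascal N n))
                                     (*-distribˡ-+ (sign n) (binomial N n) (binomial N (suc n)))) ⟩
  ∑ (suc N) (λ n → sign n * binomial N n + sign n * binomial N (suc n))
    ≡⟨ ∑-+ (suc N) (λ n → sign n * binomial N n) (λ n → sign n * binomial N (suc n)) ⟩
  (sign 0 * binomial N 0 + ∑ N (λ n → ((- 1ℚ) * sign n) * binomial N (suc n)))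
    + ∑ (suc N) (λ n → sign n * binomial N (suc n))
    ≡⟨ cong₂ (λ a b → (sign 0 * binomial N 0 + a) + b)
         (trans (∑-cong N (λ n _ → *-assoc (- 1ℚ) (sign n) _)) (∑-*ˡ N (- 1ℚ) (λ n → sign n * binomial N (suc n))))
         (∑-snoc N (λ n → sign n * binomial N (suc n))) ⟩
  (sign 0 * binomial N 0 + (- 1ℚ) * A) + (A + sign N * binomial N (suc N))
    ≡⟨ cong₂ (λ a b → (sign 0 * a + (- 1ℚ) * A) + (A + sign N * b)) (binomial-0 N) (binomial-suc N) ⟩
  (1ℚ * 1ℚ + (- 1ℚ) * A) + (A + sign N * 0ℚ)
    ≡⟨ telescope A (sign N) ⟩
  1ℚ
    ∎
  where
  open ≡-Reasoning
  A : ℚ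
  A = ∑ N (λ n → sign n * binomial N (suc n))
  telescope : ∀ a s → (1ℚ * 1ℚ + (- 1ℚ) * a) + (a + s * 0ℚ) ≡ 1ℚ
  telescope = solve-∀ ℚ-ring

alternating-binomial-reciprocal-sum : ∀ m → ∑ (suc m) (λ n → sign n * binomial m n * 1/[1+ n ]) ≡ 1/[1+ m ]
alternating-binomial-reciprocal-sum m = begin
  ∑ (suc m) (λ n → sign n * binomial m n * 1/[1+ n ])
    ≡⟨ ∑-cong (suc m) (λ n _ → trans (*-assoc (sign n) (binomial m n) 1/[1+ n ])
         (trans (cong (sign n *_) (binomial-absorption⁻¹ m n)) (x[yz]≡y[xz] (sign n) 1/[1+ m ] (binomial (suc m) (suc n))))) ⟩
  ∑ (suc m) (λ n → 1/[1+ m ] * (sign n * binomial (suc m) (suc n)))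
    ≡⟨ ∑-*ˡ (suc m) 1/[1+ m ] (λ n → sign n * binomial (suc m) (suc n)) ⟩
  1/[1+ m ] * ∑ (suc m) (λ n → sign n * binomial (suc m) (suc n))
    ≡⟨ cong (1/[1+ m ] *_) (alternating-binomial-sum m) ⟩
  1/[1+ m ] * 1ℚ
    ≡⟨ *-identityʳ _ ⟩
  1/[1+ m ]
    ∎
  where
  open ≡-Reasoning
  x[yz]≡y[xz] : ∀ a b c → a * (b * c) ≡ b * (a * c)
  x[yz]≡y[xz] = solve-∀ ℚ-ring

harmonic : ℕ → ℚ
harmonic m = ∑ m 1/[1+_]

alternating-binomial-harmonic : ∀ m → ∑ m (λ n → sign n * binomial m (suc n) * 1/[1+ n ]) ≡ harmonic m
alternating-binomial-harmonic zero    = refl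
alternating-binomial-harmonic (suc m) = begin
  ∑ (suc m) (λ n → sign n * binomial (suc m) (suc n) * 1/[1+ n ])
    ≡⟨ ∑-cong (suc m) (λ n _ → trans (cong (λ c → sign n * c * 1/[1+ n ]) (binomial-pascal m n))
                                      (distrib (sign n) (binomial m n) (binomial m (suc n)) 1/[1+ n ])) ⟩
  ∑ (suc m) (λ n → sign n * binomial m (suc n) * 1/[1+ n ] + sign n * binomial m n * 1/[1+ n ])
    ≡⟨ ∑-+ (suc m) (λ n → sign n * binomial m (suc n) * 1/[1+ n ]) (λ n → sign n * binomial m n * 1/[1+ n ]) ⟩
  ∑ (suc m) (λ n → sign n * binomial m (suc n) * 1/[1+ n ]) + ∑ (suc m) (λ n → sign n * binomial m n * 1/[1+ n ])
    ≡⟨ cong₂ _+_ (∑-snoc m (λ n → sign n * binomial m (suc n) * 1/[1+ n ])) (alternating-binomial-reciprocal-sum m) ⟩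
  (∑ m (λ n → sign n * binomial m (suc n) * 1/[1+ n ]) + sign m * binomial m (suc m) * 1/[1+ m ]) + 1/[1+ m ]
    ≡⟨ cong₂ (λ h c → (h + sign m * c * 1/[1+ m ]) + 1/[1+ m ]) (alternating-binomial-harmonic m) (binomial-suc m) ⟩
  (harmonic m + sign m * 0ℚ * 1/[1+ m ]) + 1/[1+ m ]
    ≡⟨ cong (_+ 1/[1+ m ]) (drop (harmonic m) (sign m) 1/[1+ m ]) ⟩
  harmonic m + 1/[1+ m ]
    ≡⟨ ∑-snoc m 1/[1+_] ⟨
  harmonic (suc m)
    ∎
  where
  open ≡-Reasoning
  distrib : ∀ s a b r → s * (a + b) * r ≡ s * b * r + s * a * r
  distrib = solve-∀ ℚ-ring
  drop : ∀ h s r → h + s * 0ℚ * r ≡ h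
  drop = solve-∀ ℚ-ring

∑-alternating-reciprocal : ∀ n →
  ∑ (2 ℕ.* n) (λ j → sign j * 1/[1+ j ]) ≡ ∑ n (λ j → 1/[1+ 2 ℕ.* j ]) + -½ * harmonic n
∑-alternating-reciprocal n = begin
  ∑ (2 ℕ.* n) (λ j → sign j * 1/[1+ j ])
    ≡⟨ ∑-pairs n (λ j → sign j * 1/[1+ j ]) ⟩
  ∑ n (λ j → sign (2 ℕ.* j) * 1/[1+ 2 ℕ.* j ] + (- 1ℚ * sign (2 ℕ.* j)) * 1/[1+ suc (2 ℕ.* j) ])
    ≡⟨ ∑-cong n (λ j _ → trans (cong₂ (λ s r → s * 1/[1+ 2 ℕ.* j ] + (- 1ℚ * s) * r)
                                       (sign-even j) (1/[1+2j+1]≡½*1/[1+j] j))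
                                (simplify 1/[1+ 2 ℕ.* j ] 1/[1+ j ])) ⟩
  ∑ n (λ j → 1/[1+ 2 ℕ.* j ] + -½ * 1/[1+ j ])
    ≡⟨ ∑-+ n (λ j → 1/[1+ 2 ℕ.* j ]) (λ j → -½ * 1/[1+ j ]) ⟩
  ∑ n (λ j → 1/[1+ 2 ℕ.* j ]) + ∑ n (λ j → -½ * 1/[1+ j ])
    ≡⟨ cong (_+_ (∑ n (λ j → 1/[1+ 2 ℕ.* j ]))) (∑-*ˡ n -½ 1/[1+_]) ⟩
  ∑ n (λ j → 1/[1+ 2 ℕ.* j ]) + -½ * harmonic n
    ∎
  where
  open ≡-Reasoning
  simplify : ∀ a b → 1ℚ * a + (- 1ℚ * 1ℚ) * (½ * b) ≡ a + -½ * b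
  simplify = solve-∀ ℚ-ring

scaledCentralBinomial : ℕ → ℚ
scaledCentralBinomial n = term n * fromℕ (suc (2 ℕ.* n))

term≡scaledCentralBinomial*1/[1+2n] : ∀ n → term n ≡ scaledCentralBinomial n * 1/[1+ 2 ℕ.* n ]
term≡scaledCentralBinomial*1/[1+2n] n = x*[1+d]≡y⇒x≡y*1/[1+d] (2 ℕ.* n) refl

scaledCentralBinomial-0 : scaledCentralBinomial 0 ≡ 1ℚ
scaledCentralBinomial-0 = cong (term 0 *_) fromℤ-1

scaledCentralBinomial*4^n : ∀ n → scaledCentralBinomial n * fromℕ (4 ℕ.^ n) ≡ binomial (2 ℕ.* n) n
scaledCentralBinomial*4^n n = begin
  term n * fromℕ (suc (2 ℕ.* n)) * fromℕ (4 ℕ.^ n)   ≡⟨ xyz≡x[zy] (term n) _ _ ⟩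
  term n * (fromℕ (4 ℕ.^ n) * fromℕ (suc (2 ℕ.* n))) ≡⟨ cong (term n *_) (fromℕ-homo-* (4 ℕ.^ n) _) ⟨
  term n * fromℕ (4 ℕ.^ n ℕ.* suc (2 ℕ.* n))         ≡⟨ /-*-cancel (+ ((2 ℕ.* n) C n)) _ {{4^n*[1+2n]≢0}} ⟩
  binomial (2 ℕ.* n) n                                ∎
  where
  open ≡-Reasoning
  4^n*[1+2n]≢0 : NonZero (4 ℕ.^ n ℕ.* suc (2 ℕ.* n))
  4^n*[1+2n]≢0 = ℕ.m*n≢0 (4 ℕ.^ n) (suc (2 ℕ.* n)) {{ℕ.m^n≢0 4 n}}
  xyz≡x[zy] : ∀ x y z → x * y * z ≡ x * (z * y)
  xyz≡x[zy] = solve-∀ ℚ-ring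

scaledCentralBinomial-suc : ∀ n →
  scaledCentralBinomial (suc n) * fromℕ (suc (suc (2 ℕ.* n))) ≡ scaledCentralBinomial n * fromℕ (suc (2 ℕ.* n))
scaledCentralBinomial-suc n = *-cancelʳ-fromℕ (2 ℕ.* 4 ℕ.^ n) {{2*4^n≢0}} (begin
  S′ * fromℕ (suc (suc (2 ℕ.* n))) * fromℕ (2 ℕ.* 4 ℕ.^ n)
    ≡⟨ *-assoc S′ _ _ ⟩
  S′ * (fromℕ (suc (suc (2 ℕ.* n))) * fromℕ (2 ℕ.* 4 ℕ.^ n))
    ≡⟨ cong (S′ *_) (fromℕ-homo-* (suc (suc (2 ℕ.* n))) _) ⟨
  S′ * fromℕ (suc (suc (2 ℕ.* n)) ℕ.* (2 ℕ.* 4 ℕ.^ n))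
    ≡⟨ cong (λ k → S′ * fromℕ k) (reorder n (4 ℕ.^ n)) ⟩
  S′ * fromℕ (4 ℕ.^ suc n ℕ.* suc n)
    ≡⟨ cong (S′ *_) (fromℕ-homo-* (4 ℕ.^ suc n) (suc n)) ⟩
  S′ * (fromℕ (4 ℕ.^ suc n) * fromℕ (suc n))
    ≡⟨ *-assoc S′ _ _ ⟨
  S′ * fromℕ (4 ℕ.^ suc n) * fromℕ (suc n)
    ≡⟨ cong (_* fromℕ (suc n)) (scaledCentralBinomial*4^n (suc n)) ⟩
  binomial (2 ℕ.* suc n) (suc n) * fromℕ (suc n)
    ≡⟨ fromℕ-homo-* _ (suc n) ⟨
  fromℕ (((2 ℕ.* suc n) C suc n) ℕ.* suc n)
    ≡⟨ cong fromℕ (central-binomial-rec n) ⟩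
  fromℕ (2 ℕ.* suc (2 ℕ.* n) ℕ.* ((2 ℕ.* n) C n))
    ≡⟨ trans (fromℕ-homo-* (2 ℕ.* suc (2 ℕ.* n)) _) (cong (_* binomial (2 ℕ.* n) n) (fromℕ-homo-* 2 _)) ⟩
  fromℕ 2 * fromℕ (suc (2 ℕ.* n)) * binomial (2 ℕ.* n) n
    ≡⟨ cong (fromℕ 2 * fromℕ (suc (2 ℕ.* n)) *_) (scaledCentralBinomial*4^n n) ⟨
  fromℕ 2 * fromℕ (suc (2 ℕ.* n)) * (S * fromℕ (4 ℕ.^ n))
    ≡⟨ regroup (fromℕ 2) _ S _ ⟩
  S * fromℕ (suc (2 ℕ.* n)) * (fromℕ 2 * fromℕ (4 ℕ.^ n))
    ≡⟨ cong (S * fromℕ (suc (2 ℕ.* n)) *_) (fromℕ-homo-* 2 (4 ℕ.^ n)) ⟨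
  S * fromℕ (suc (2 ℕ.* n)) * fromℕ (2 ℕ.* 4 ℕ.^ n)
    ∎)
  where
  open ≡-Reasoning
  2*4^n≢0 : NonZero (2 ℕ.* 4 ℕ.^ n)
  2*4^n≢0 = ℕ.m*n≢0 2 (4 ℕ.^ n) {{_}} {{ℕ.m^n≢0 4 n}}
  S′ S : ℚ
  S′ = scaledCentralBinomial (suc n)
  S  = scaledCentralBinomial n
  reorder : ∀ n x → suc (suc (2 ℕ.* n)) ℕ.* (2 ℕ.* x) ≡ 4 ℕ.* x ℕ.* suc n
  reorder = ℕSolver.solve-∀
  regroup : ∀ t o s f → t * o * (s * f) ≡ s * o * (t * f)
  regroup = solve-∀ ℚ-ring

module ModPrime (p : ℕ) (p-prime : Prime p) where

  p∤1 : ¬ p ∣ 1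
  p∤1 p∣1 = ¬prime[1] (subst Prime (∣1⇒≡1 p∣1) p-prime)

  p∤* : ∀ {a b} → ¬ p ∣ a → ¬ p ∣ b → ¬ p ∣ a ℕ.* b
  p∤* {a} {b} p∤a p∤b p∣ab with euclidsLemma a b p-prime p∣ab
  ... | inj₁ p∣a = p∤a p∣a
  ... | inj₂ p∣b = p∤b p∣b

  record Integral (x : ℚ) : Set where
    constructor integral
    field
      numerator               : ℤ
      denominator             : ℕ
      p∤denominator           : ¬ p ∣ denominator
      x*denominator≡numerator : x * fromℕ denominator ≡ fromℤ numerator

  Integral-fromℤ : ∀ i → Integral (fromℤ i)
  Integral-fromℤ i = integral i 1 p∤1 (trans (cong (fromℤ i *_) fromℤ-1) (*-identityʳ (fromℤ i)))

  Integral-fromℕ : ∀ n → Integral (fromℕ n)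
  Integral-fromℕ n = Integral-fromℤ (+ n)

  p∤1+n⇒Integral-1/[1+n] : ∀ {n} → ¬ p ∣ suc n → Integral 1/[1+ n ]
  p∤1+n⇒Integral-1/[1+n] {n} p∤1+n = integral (+ 1) (suc n) p∤1+n (trans (1/[1+n]*[1+n]≡1 n) (sym fromℤ-1))

  Integral-+ : ∀ {x y} → Integral x → Integral y → Integral (x + y)
  Integral-+ {x} {y} (integral a b p∤b xb≡a) (integral c d p∤d yd≡c) =
    integral (a ℤ.* + d ℤ.+ c ℤ.* + b) (b ℕ.* d) (p∤* p∤b p∤d) (begin
      (x + y) * fromℕ (b ℕ.* d)                        ≡⟨ cong ((x + y) *_) (fromℕ-homo-* b d) ⟩
      (x + y) * (fromℕ b * fromℕ d)                    ≡⟨ expand x y (fromℕ b) (fromℕ d) ⟩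
      (x * fromℕ b) * fromℕ d + (y * fromℕ d) * fromℕ b ≡⟨ cong₂ (λ u v → u * fromℕ d + v * fromℕ b) xb≡a yd≡c ⟩
      fromℤ a * fromℤ (+ d) + fromℤ c * fromℤ (+ b)    ≡⟨ cong₂ _+_ (fromℤ-homo-* a (+ d)) (fromℤ-homo-* c (+ b)) ⟨
      fromℤ (a ℤ.* + d) + fromℤ (c ℤ.* + b)            ≡⟨ fromℤ-homo-+ (a ℤ.* + d) (c ℤ.* + b) ⟨
      fromℤ (a ℤ.* + d ℤ.+ c ℤ.* + b)                  ∎)
    where
    open ≡-Reasoning
    expand : ∀ x y b d → (x + y) * (b * d) ≡ (x * b) * d + (y * d) * b
    expand = solve-∀ ℚ-ring

  Integral-* : ∀ {x y} → Integral x → Integral y → Integral (x * y)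
  Integral-* {x} {y} (integral a b p∤b xb≡a) (integral c d p∤d yd≡c) =
    integral (a ℤ.* c) (b ℕ.* d) (p∤* p∤b p∤d) (begin
      (x * y) * fromℕ (b ℕ.* d)         ≡⟨ cong ((x * y) *_) (fromℕ-homo-* b d) ⟩
      (x * y) * (fromℕ b * fromℕ d)     ≡⟨ interchange x y (fromℕ b) (fromℕ d) ⟩
      (x * fromℕ b) * (y * fromℕ d)     ≡⟨ cong₂ _*_ xb≡a yd≡c ⟩
      fromℤ a * fromℤ c                 ≡⟨ fromℤ-homo-* a c ⟨
      fromℤ (a ℤ.* c)                   ∎)
    where
    open ≡-Reasoning
    interchange : ∀ x y b d → (x * y) * (b * d) ≡ (x * b) * (y * d)
    interchange = solve-∀ ℚ-ring

  Integral-neg : ∀ {x} → Integral x → Integral (- x)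
  Integral-neg {x} (integral a b p∤b xb≡a) = integral (ℤ.- a) b p∤b (begin
    - x * fromℕ b     ≡⟨ neg-distribˡ-* x (fromℕ b) ⟨
    - (x * fromℕ b)   ≡⟨ cong -_ xb≡a ⟩
    - fromℤ a         ≡⟨ fromℤ-homo‿- a ⟨
    fromℤ (ℤ.- a)     ∎)
    where open ≡-Reasoning

  Integral-sign : ∀ n → Integral (sign n)
  Integral-sign zero    = subst Integral fromℤ-1 (Integral-fromℤ (+ 1))
  Integral-sign (suc n) = Integral-* (Integral-neg (Integral-sign zero)) (Integral-sign n)

  infix 4 _≈_
  record _≈_ (x y : ℚ) : Set where
    constructor by
    field
      {quotient}        : ℚ
      integral-quotient : Integral quotient
      difference        : x - y ≡ fromℕ p * quotient

  ≡⇒≈ : ∀ {x y} → x ≡ y → x ≈ y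
  ≡⇒≈ {x} refl = by (subst Integral fromℤ-0 (Integral-fromℤ (+ 0))) (x-x≡p*0 x (fromℕ p))
    where
    x-x≡p*0 : ∀ x p → x - x ≡ p * 0ℚ
    x-x≡p*0 = solve-∀ ℚ-ring

  ≈-refl : ∀ {x} → x ≈ x
  ≈-refl = ≡⇒≈ refl

  ≈-sym : ∀ {x y} → x ≈ y → y ≈ x
  ≈-sym {x} {y} (by {q} q-int x-y≡pq) = by (Integral-neg q-int) (begin
    y - x              ≡⟨ swap x y ⟩
    - (x - y)          ≡⟨ cong -_ x-y≡pq ⟩
    - (fromℕ p * q)    ≡⟨ neg-distribʳ-* (fromℕ p) q ⟩
    fromℕ p * - q      ∎)
    where
    open ≡-Reasoning
    swap : ∀ x y → y - x ≡ - (x - y)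
    swap = solve-∀ ℚ-ring

  ≈-+ : ∀ {x y u v} → x ≈ y → u ≈ v → x + u ≈ y + v
  ≈-+ {x} {y} {u} {v} (by {q} q-int x-y≡pq) (by {r} r-int u-v≡pr) = by (Integral-+ q-int r-int) (begin
    (x + u) - (y + v)             ≡⟨ regroup x y u v ⟩
    (x - y) + (u - v)             ≡⟨ cong₂ _+_ x-y≡pq u-v≡pr ⟩
    fromℕ p * q + fromℕ p * r     ≡⟨ *-distribˡ-+ (fromℕ p) q r ⟨
    fromℕ p * (q + r)             ∎)
    where
    open ≡-Reasoning
    regroup : ∀ x y u v → (x + u) - (y + v) ≡ (x - y) + (u - v)
    regroup = solve-∀ ℚ-ring

  ≈-trans : ∀ {x y z} → x ≈ y → y ≈ z → x ≈ z
  ≈-trans {x} {y} {z} (by {q} q-int x-y≡pq) (by {r} r-int y-z≡pr) = by (Integral-+ q-int r-int) (begin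
    x - z                         ≡⟨ telescope x y z ⟩
    (x - y) + (y - z)             ≡⟨ cong₂ _+_ x-y≡pq y-z≡pr ⟩
    fromℕ p * q + fromℕ p * r     ≡⟨ *-distribˡ-+ (fromℕ p) q r ⟨
    fromℕ p * (q + r)             ∎)
    where
    open ≡-Reasoning
    telescope : ∀ x y z → x - z ≡ (x - y) + (y - z)
    telescope = solve-∀ ℚ-ring

  ≈-isEquivalence : IsEquivalence _≈_
  ≈-isEquivalence = record { refl = ≈-refl ; sym = ≈-sym ; trans = ≈-trans }

  ≈-setoid : Setoid _ _
  ≈-setoid = record { isEquivalence = ≈-isEquivalence }

  module ≈-Reasoning = SetoidReasoning ≈-setoid

  ≈-neg : ∀ {x y} → x ≈ y → - x ≈ - y
  ≈-neg {x} {y} (by {q} q-int x-y≡pq) = by (Integral-neg q-int) (begin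
    - x - - y          ≡⟨ neg-distrib x y ⟩
    - (x - y)          ≡⟨ cong -_ x-y≡pq ⟩
    - (fromℕ p * q)    ≡⟨ neg-distribʳ-* (fromℕ p) q ⟩
    fromℕ p * - q      ∎)
    where
    open ≡-Reasoning
    neg-distrib : ∀ x y → - x - - y ≡ - (x - y)
    neg-distrib = solve-∀ ℚ-ring

  ≈-*ˡ : ∀ {c x y} → Integral c → x ≈ y → c * x ≈ c * y
  ≈-*ˡ {c} {x} {y} c-int (by {q} q-int x-y≡pq) = by (Integral-* c-int q-int) (begin
    c * x - c * y       ≡⟨ factor c x y ⟩
    c * (x - y)         ≡⟨ cong (c *_) x-y≡pq ⟩
    c * (fromℕ p * q)   ≡⟨ x[yz]≡y[xz] c (fromℕ p) q ⟩
    fromℕ p * (c * q)   ∎)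
    where
    open ≡-Reasoning
    factor : ∀ c x y → c * x - c * y ≡ c * (x - y)
    factor = solve-∀ ℚ-ring
    x[yz]≡y[xz] : ∀ a b c → a * (b * c) ≡ b * (a * c)
    x[yz]≡y[xz] = solve-∀ ℚ-ring

  ≈-*ʳ : ∀ {c x y} → Integral c → x ≈ y → x * c ≈ y * c
  ≈-*ʳ {c} {x} {y} c-int x≈y = subst₂ _≈_ (*-comm c x) (*-comm c y) (≈-*ˡ c-int x≈y)

  ≈-∑ : ∀ n {f g} → (∀ i → i < n → f i ≈ g i) → ∑ n f ≈ ∑ n g
  ≈-∑ zero    f≈g = ≈-refl
  ≈-∑ (suc n) f≈g = ≈-+ (f≈g 0 (ℕ.s≤s ℕ.z≤n)) (≈-∑ n (λ i i<n → f≈g (suc i) (ℕ.s≤s i<n)))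

  x+p*y≈x : ∀ {x y} → Integral y → x + fromℕ p * y ≈ x
  x+p*y≈x {x} {y} y-int = by y-int (x+z-x≡z x (fromℕ p * y))
    where
    x+z-x≡z : ∀ x z → x + z - x ≡ z
    x+z-x≡z = solve-∀ ℚ-ring

  p*integral⇒p∣numerator : ∀ r {q} → Integral q → r ≡ fromℕ p * q → p ∣ ℤ.∣ ↥ r ∣ × ¬ p ∣ ↧ₙ r
  p*integral⇒p∣numerator r@(mkℚ n d coprime) {q} (integral a b p∤b qb≡a) r≡pq = p∣n , p∤d
    where
    rb≡pa : r * fromℕ b ≡ fromℤ (+ p ℤ.* a)
    rb≡pa = begin
      r * fromℕ b               ≡⟨ cong (_* fromℕ b) r≡pq ⟩
      fromℕ p * q * fromℕ b     ≡⟨ *-assoc (fromℕ p) q (fromℕ b) ⟩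
      fromℕ p * (q * fromℕ b)   ≡⟨ cong (fromℕ p *_) qb≡a ⟩
      fromℕ p * fromℤ a         ≡⟨ fromℤ-homo-* (+ p) a ⟨
      fromℤ (+ p ℤ.* a)         ∎
      where open ≡-Reasoning
    cross : ℤ.∣ n ∣ ℕ.* b ≡ p ℕ.* (ℤ.∣ a ∣ ℕ.* suc d)
    cross = begin
      ℤ.∣ n ∣ ℕ.* b                    ≡⟨ ℤ.abs-* n (+ b) ⟨
      ℤ.∣ n ℤ.* + b ∣                  ≡⟨ cong ℤ.∣_∣ (r*b≡a⇒↥r*b≡a*↧r r b (+ p ℤ.* a) rb≡pa) ⟩
      ℤ.∣ + p ℤ.* a ℤ.* + suc d ∣      ≡⟨ cong ℤ.∣_∣ (ℤ.*-assoc (+ p) a (+ suc d)) ⟩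
      ℤ.∣ + p ℤ.* (a ℤ.* + suc d) ∣    ≡⟨ ℤ.abs-* (+ p) (a ℤ.* + suc d) ⟩
      p ℕ.* ℤ.∣ a ℤ.* + suc d ∣        ≡⟨ cong (p ℕ.*_) (ℤ.abs-* a (+ suc d)) ⟩
      p ℕ.* (ℤ.∣ a ∣ ℕ.* suc d)        ∎
      where open ≡-Reasoning
    p∣n : p ∣ ℤ.∣ n ∣
    p∣n with euclidsLemma ℤ.∣ n ∣ b p-prime (divides (ℤ.∣ a ∣ ℕ.* suc d) (trans cross (ℕ.*-comm p _)))
    ... | inj₁ p∣n = p∣n
    ... | inj₂ p∣b = ⊥-elim (p∤b p∣b)
    p∤d : ¬ p ∣ suc d
    p∤d p∣d = p∤b (∣-trans p∣d (coprime-divisor (coprime-sym (recompute coprime))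
      (divides (p ℕ.* ℤ.∣ a ∣) (trans cross (sym (ℕ.*-assoc p ℤ.∣ a ∣ (suc d)))))))

  ≈⇒≡[modℚ] : ∀ {x y} → x ≈ y → x ≡ y [modℚ p ]
  ≈⇒≡[modℚ] {x} {y} (by q-int x-y≡pq) = p*integral⇒p∣numerator (x - y) q-int x-y≡pq

module OddPrime (k : ℕ) (p-prime : Prime (suc (2 ℕ.* suc k))) where

  m : ℕ
  m = suc k

  p : ℕ
  p = suc (2 ℕ.* m)

  open ModPrime p p-prime

  Integral-1/[1+j] : ∀ {j} → j < 2 ℕ.* m → Integral 1/[1+ j ]
  Integral-1/[1+j] {j} j<2m = p∤1+n⇒Integral-1/[1+n] (λ p∣1+j → ℕ.<⇒≱ (ℕ.s≤s j<2m) (∣⇒≤ p∣1+j))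

  Integral-½ : Integral ½
  Integral-½ = Integral-1/[1+j] {1} (ℕ.*-monoʳ-≤ 2 (ℕ.s≤s {n = k} ℕ.z≤n))

  1/[1+a]≈-1/[1+b] : ∀ a b → suc a ℕ.+ suc b ≡ p → 1/[1+ a ] ≈ - 1/[1+ b ]
  1/[1+a]≈-1/[1+b] a b a+b≡p = by (Integral-* (Integral-1/[1+j] a<2m) (Integral-1/[1+j] b<2m)) (begin
    1/[1+ a ] - - 1/[1+ b ]                           ≡⟨ x--y≡x+y 1/[1+ a ] 1/[1+ b ] ⟩
    1/[1+ a ] + 1/[1+ b ]                             ≡⟨ 1/[1+a]+1/[1+b] a b ⟩
    fromℕ (suc a ℕ.+ suc b) * (1/[1+ a ] * 1/[1+ b ]) ≡⟨ cong (λ n → fromℕ n * (1/[1+ a ] * 1/[1+ b ])) a+b≡p ⟩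
    fromℕ p * (1/[1+ a ] * 1/[1+ b ])                 ∎)
    where
    open ≡-Reasoning
    a<2m : a < 2 ℕ.* m
    a<2m = subst (a <_) (ℕ.suc-injective a+b≡p) (ℕ.m<m+n a (ℕ.s≤s ℕ.z≤n))
    b<2m : b < 2 ℕ.* m
    b<2m = subst (b <_) (ℕ.suc-injective a+b≡p) (ℕ.m≤n+m (suc b) a)
    x--y≡x+y : ∀ x y → x - - y ≡ x + y
    x--y≡x+y = solve-∀ ℚ-ring

  binomial[p,1+j]≡p*binomial[p-1,j]/[1+j] : ∀ j → binomial p (suc j) ≡ fromℕ p * (binomial (2 ℕ.* m) j * 1/[1+ j ])
  binomial[p,1+j]≡p*binomial[p-1,j]/[1+j] j = trans (binomial-suc-suc (2 ℕ.* m) j) (*-assoc (fromℕ p) _ _)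

  binomial[p-1,j]≈sign : ∀ j → j ℕ.≤ 2 ℕ.* m → binomial (2 ℕ.* m) j ≈ sign j
  binomial[p-1,j]≈sign zero    _     = ≡⇒≈ (binomial-0 (2 ℕ.* m))
  binomial[p-1,j]≈sign (suc j) j<2m = begin
    binomial (2 ℕ.* m) (suc j)
      ≡⟨ c≡a+b⇒b≡-a+c (binomial (2 ℕ.* m) j) _ _ (binomial-pascal (2 ℕ.* m) j) ⟩
    - binomial (2 ℕ.* m) j + binomial p (suc j)
      ≡⟨ cong (_+_ (- binomial (2 ℕ.* m) j)) (binomial[p,1+j]≡p*binomial[p-1,j]/[1+j] j) ⟩
    - binomial (2 ℕ.* m) j + fromℕ p * (binomial (2 ℕ.* m) j * 1/[1+ j ])
      ≈⟨ x+p*y≈x (Integral-* (Integral-fromℕ _) (Integral-1/[1+j] j<2m)) ⟩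
    - binomial (2 ℕ.* m) j
      ≈⟨ ≈-neg (binomial[p-1,j]≈sign j (ℕ.<⇒≤ j<2m)) ⟩
    - sign j
      ≡⟨ sign-suc j ⟨
    sign (suc j)
      ∎
    where
    open ≈-Reasoning
    c≡a+b⇒b≡-a+c : ∀ a b c → c ≡ a + b → b ≡ - a + c
    c≡a+b⇒b≡-a+c a b c c≡a+b = trans (sym (-x+[x+y]≡y a b)) (cong (_+_ (- a)) (sym c≡a+b))
      where
      -x+[x+y]≡y : ∀ x y → - x + (x + y) ≡ y
      -x+[x+y]≡y = solve-∀ ℚ-ring

  1/[1+2n]≈-½*1/[1+k-n] : ∀ {n} → n < m → 1/[1+ 2 ℕ.* n ] ≈ -½ * 1/[1+ k ∸ n ]
  1/[1+2n]≈-½*1/[1+k-n] {n} n<m = begin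
    1/[1+ 2 ℕ.* n ]                        ≈⟨ 1/[1+a]≈-1/[1+b] (2 ℕ.* n) (suc (2 ℕ.* (k ∸ n))) complementary ⟩
    - 1/[1+ suc (2 ℕ.* (k ∸ n)) ]          ≡⟨ cong -_ (1/[1+2j+1]≡½*1/[1+j] (k ∸ n)) ⟩
    - (½ * 1/[1+ k ∸ n ])                  ≡⟨ neg-distribˡ-* ½ 1/[1+ k ∸ n ] ⟩
    -½ * 1/[1+ k ∸ n ]                     ∎
    where
    open ≈-Reasoning
    complementary : suc (2 ℕ.* n) ℕ.+ suc (suc (2 ℕ.* (k ∸ n))) ≡ p
    complementary = trans (double-sum n (k ∸ n)) (cong (λ j → suc (2 ℕ.* suc j)) (ℕ.m+[n∸m]≡n (ℕ.≤-pred n<m)))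
      where
      double-sum : ∀ a b → suc (2 ℕ.* a) ℕ.+ suc (suc (2 ℕ.* b)) ≡ suc (2 ℕ.* suc (a ℕ.+ b))
      double-sum = ℕSolver.solve-∀

  ∑-1/[1+2n]≈-½*harmonic : ∑ m (λ n → 1/[1+ 2 ℕ.* n ]) ≈ -½ * harmonic m
  ∑-1/[1+2n]≈-½*harmonic = begin
    ∑ m (λ n → 1/[1+ 2 ℕ.* n ])          ≈⟨ ≈-∑ m (λ n → 1/[1+2n]≈-½*1/[1+k-n]) ⟩
    ∑ m (λ n → -½ * 1/[1+ m ∸ suc n ])   ≡⟨ ∑-*ˡ m -½ (λ n → 1/[1+ m ∸ suc n ]) ⟩
    -½ * ∑ m (λ n → 1/[1+ m ∸ suc n ])   ≡⟨ cong (-½ *_) (∑-reverse m 1/[1+_]) ⟩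
    -½ * harmonic m                      ∎
    where open ≈-Reasoning

  fermatSum : ℚ
  fermatSum = ∑ (2 ℕ.* m) (λ j → binomial (2 ℕ.* m) j * 1/[1+ j ])

  2^p≡2+p*fermatSum : fromℕ (2 ℕ.^ p) ≡ 1ℚ + (fromℕ p * fermatSum + 1ℚ)
  2^p≡2+p*fermatSum = begin
    fromℕ (2 ℕ.^ p)
      ≡⟨ binomial-row-sum p ⟨
    binomial p 0 + ∑ (suc (2 ℕ.* m)) (λ j → binomial p (suc j))
      ≡⟨ cong₂ _+_ (binomial-0 p) (∑-snoc (2 ℕ.* m) (λ j → binomial p (suc j))) ⟩
    1ℚ + (∑ (2 ℕ.* m) (λ j → binomial p (suc j)) + binomial p p)
      ≡⟨ cong₂ (λ s c → 1ℚ + (s + c))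
               (∑-cong (2 ℕ.* m) (λ j _ → binomial[p,1+j]≡p*binomial[p-1,j]/[1+j] j)) (binomial-diag p) ⟩
    1ℚ + (∑ (2 ℕ.* m) (λ j → fromℕ p * (binomial (2 ℕ.* m) j * 1/[1+ j ])) + 1ℚ)
      ≡⟨ cong (λ s → 1ℚ + (s + 1ℚ)) (∑-*ˡ (2 ℕ.* m) (fromℕ p) (λ j → binomial (2 ℕ.* m) j * 1/[1+ j ])) ⟩
    1ℚ + (fromℕ p * fermatSum + 1ℚ)
      ∎
    where open ≡-Reasoning

  fermatQuotient≡½*fermatSum : fermatQuotient p (fromℤ (+ 2)) ≡ ½ * fermatSum
  fermatQuotient≡½*fermatSum = begin
    (fromℕ 2 ^ℚ (2 ℕ.* m) - 1ℚ) * r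
      ≡⟨ cong (λ e → (e - 1ℚ) * r) (trans (fromℕ-homo-^ 2 (2 ℕ.* m)) (sym (*-identityˡ E))) ⟩
    (1ℚ * E - 1ℚ) * r
      ≡⟨ cong (λ h → (h * E - 1ℚ) * r) (1/[1+n]*[1+n]≡1 1) ⟨
    (½ * fromℕ 2 * E - 1ℚ) * r
      ≡⟨ cong (λ x → (x - 1ℚ) * r) (trans (*-assoc ½ (fromℕ 2) E) (cong (½ *_) 2*E≡2+p*fermatSum)) ⟩
    (½ * (1ℚ + (fromℕ p * fermatSum + 1ℚ)) - 1ℚ) * r
      ≡⟨ simplify (fromℕ p) fermatSum r ⟩
    ½ * fermatSum * (r * fromℕ p)
      ≡⟨ cong (½ * fermatSum *_) (1/[1+n]*[1+n]≡1 (2 ℕ.* m)) ⟩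
    ½ * fermatSum * 1ℚ
      ≡⟨ *-identityʳ _ ⟩
    ½ * fermatSum
      ∎
    where
    open ≡-Reasoning
    r E : ℚ
    r = 1/[1+ 2 ℕ.* m ]
    E = fromℕ (2 ℕ.^ (2 ℕ.* m))
    2*E≡2+p*fermatSum : fromℕ 2 * E ≡ 1ℚ + (fromℕ p * fermatSum + 1ℚ)
    2*E≡2+p*fermatSum = trans (sym (fromℕ-homo-* 2 (2 ℕ.^ (2 ℕ.* m)))) 2^p≡2+p*fermatSum
    simplify : ∀ P G r → (½ * (1ℚ + (P * G + 1ℚ)) - 1ℚ) * r ≡ ½ * G * (r * P)
    simplify = solve-∀ ℚ-ring

  fermatSum≈-harmonic : fermatSum ≈ - harmonic m
  fermatSum≈-harmonic = begin
    fermatSum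
      ≈⟨ ≈-∑ (2 ℕ.* m) (λ j j<2m → ≈-*ʳ (Integral-1/[1+j] j<2m) (binomial[p-1,j]≈sign j (ℕ.<⇒≤ j<2m))) ⟩
    ∑ (2 ℕ.* m) (λ j → sign j * 1/[1+ j ])
      ≡⟨ ∑-alternating-reciprocal m ⟩
    ∑ m (λ j → 1/[1+ 2 ℕ.* j ]) + -½ * harmonic m
      ≈⟨ ≈-+ ∑-1/[1+2n]≈-½*harmonic ≈-refl ⟩
    -½ * harmonic m + -½ * harmonic m
      ≡⟨ halves (harmonic m) ⟩
    - harmonic m
      ∎
    where
    open ≈-Reasoning
    halves : ∀ h → -½ * h + -½ * h ≡ - h
    halves = solve-∀ ℚ-ring

  fermatQuotient≈-½*harmonic : fermatQuotient p (fromℤ (+ 2)) ≈ -½ * harmonic m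
  fermatQuotient≈-½*harmonic = begin
    fermatQuotient p (fromℤ (+ 2))   ≡⟨ fermatQuotient≡½*fermatSum ⟩
    ½ * fermatSum                    ≈⟨ ≈-*ˡ Integral-½ fermatSum≈-harmonic ⟩
    ½ * - harmonic m                 ≡⟨ neg-distribʳ-* ½ (harmonic m) ⟨
    - (½ * harmonic m)               ≡⟨ neg-distribˡ-* ½ (harmonic m) ⟩
    -½ * harmonic m                  ∎
    where open ≈-Reasoning

  signedBinomial : ℕ → ℚ
  signedBinomial n = sign n * binomial m n

  Integral-signedBinomial : ∀ n → Integral (signedBinomial n)
  Integral-signedBinomial n = Integral-* (Integral-sign n) (Integral-fromℕ (m C n))

  signedBinomial-suc : ∀ n → signedBinomial (suc n) * fromℕ (suc (suc (2 ℕ.* n)))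
                              ≡ signedBinomial n * (fromℕ (suc (2 ℕ.* n)) - fromℕ p)
  signedBinomial-suc n = begin
    (- 1ℚ * sign n) * binomial m (suc n) * fromℕ (suc (suc (2 ℕ.* n)))
      ≡⟨ cong (λ k → (- 1ℚ * sign n) * binomial m (suc n) * fromℕ k) (ℕ.*-suc 2 n) ⟨
    (- 1ℚ * sign n) * binomial m (suc n) * fromℕ (2 ℕ.* suc n)
      ≡⟨ cong ((- 1ℚ * sign n) * binomial m (suc n) *_) (fromℕ-homo-* 2 (suc n)) ⟩
    (- 1ℚ * sign n) * binomial m (suc n) * (fromℕ 2 * fromℕ (suc n))
      ≡⟨ regroup (sign n) (binomial m (suc n)) (fromℕ 2) (fromℕ (suc n)) ⟩
    (- 1ℚ * sign n) * fromℕ 2 * (binomial m (suc n) * fromℕ (suc n))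
      ≡⟨ cong ((- 1ℚ * sign n) * fromℕ 2 *_) (binomial-ratio m n) ⟩
    (- 1ℚ * sign n) * fromℕ 2 * (binomial m n * (fromℕ m - fromℕ n))
      ≡⟨ rearrange (sign n) (fromℕ 2) (binomial m n) (fromℕ m) (fromℕ n) ⟩
    sign n * binomial m n * ((1ℚ + fromℕ 2 * fromℕ n) - (1ℚ + fromℕ 2 * fromℕ m))
      ≡⟨ cong₂ (λ a b → sign n * binomial m n * (a - b)) (fromℕ-2n+1 n) (fromℕ-2n+1 m) ⟨
    sign n * binomial m n * (fromℕ (suc (2 ℕ.* n)) - fromℕ p)
      ∎
    where
    open ≡-Reasoning
    regroup : ∀ s c t x → (- 1ℚ * s) * c * (t * x) ≡ (- 1ℚ * s) * t * (c * x)
    regroup = solve-∀ ℚ-ring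
    rearrange : ∀ s t c M N → (- 1ℚ * s) * t * (c * (M - N)) ≡ s * c * ((1ℚ + t * N) - (1ℚ + t * M))
    rearrange = solve-∀ ℚ-ring

  scaledCentralBinomial≈signedBinomial : ∀ n → n ℕ.≤ m → scaledCentralBinomial n ≈ signedBinomial n
  scaledCentralBinomial≈signedBinomial zero    _     =
    ≡⇒≈ (trans scaledCentralBinomial-0 (sym (trans (*-identityˡ _) (binomial-0 m))))
  scaledCentralBinomial≈signedBinomial (suc n) 1+n≤m = begin
    scaledCentralBinomial (suc n)
      ≡⟨ x*[1+d]≡y⇒x≡y*1/[1+d] (suc (2 ℕ.* n)) (scaledCentralBinomial-suc n) ⟩
    scaledCentralBinomial n * O * r
      ≈⟨ ≈-*ʳ r-integral (≈-*ʳ (Integral-fromℕ _) (scaledCentralBinomial≈signedBinomial n (ℕ.<⇒≤ 1+n≤m))) ⟩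
    signedBinomial n * O * r
      ≡⟨ split (signedBinomial n) O (fromℕ p) r ⟩
    signedBinomial n * (O - fromℕ p) * r + fromℕ p * (signedBinomial n * r)
      ≈⟨ x+p*y≈x (Integral-* (Integral-signedBinomial n) r-integral) ⟩
    signedBinomial n * (O - fromℕ p) * r
      ≡⟨ x*[1+d]≡y⇒x≡y*1/[1+d] (suc (2 ℕ.* n)) (signedBinomial-suc n) ⟨
    signedBinomial (suc n)
      ∎
    where
    open ≈-Reasoning
    O r : ℚ
    O = fromℕ (suc (2 ℕ.* n))
    r = 1/[1+ suc (2 ℕ.* n) ]
    r-integral : Integral r
    r-integral = Integral-1/[1+j] (subst (ℕ._≤ 2 ℕ.* m) (ℕ.*-suc 2 n) (ℕ.*-monoʳ-≤ 2 1+n≤m))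
    split : ∀ v o P r → v * o * r ≡ v * (o - P) * r + P * (v * r)
    split = solve-∀ ℚ-ring

  term≈-½*signedBinomial*1/[1+k-n] : ∀ {n} → n < m → term n ≈ -½ * (signedBinomial n * 1/[1+ k ∸ n ])
  term≈-½*signedBinomial*1/[1+k-n] {n} n<m = begin
    term n
      ≡⟨ term≡scaledCentralBinomial*1/[1+2n] n ⟩
    scaledCentralBinomial n * 1/[1+ 2 ℕ.* n ]
      ≈⟨ ≈-*ʳ (Integral-1/[1+j] 2n<2m) (scaledCentralBinomial≈signedBinomial n (ℕ.<⇒≤ n<m)) ⟩
    signedBinomial n * 1/[1+ 2 ℕ.* n ]
      ≈⟨ ≈-*ˡ (Integral-signedBinomial n) (1/[1+2n]≈-½*1/[1+k-n] n<m) ⟩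
    signedBinomial n * (-½ * 1/[1+ k ∸ n ])
      ≡⟨ x[yz]≡y[xz] (signedBinomial n) -½ 1/[1+ k ∸ n ] ⟩
    -½ * (signedBinomial n * 1/[1+ k ∸ n ])
      ∎
    where
    open ≈-Reasoning
    2n<2m : 2 ℕ.* n < 2 ℕ.* m
    2n<2m = ℕ.*-monoʳ-< 2 n<m
    x[yz]≡y[xz] : ∀ a b c → a * (b * c) ≡ b * (a * c)
    x[yz]≡y[xz] = solve-∀ ℚ-ring

  ∑-signedBinomial-reversed : ∑ m (λ n → signedBinomial n * 1/[1+ k ∸ n ]) ≡ sign k * harmonic m
  ∑-signedBinomial-reversed = begin
    ∑ m (λ n → signedBinomial n * 1/[1+ k ∸ n ])
      ≡⟨ ∑-cong m (λ n n<m → cong (λ i → signedBinomial i * 1/[1+ k ∸ n ]) (ℕ.m∸[m∸n]≡n (ℕ.≤-pred n<m))) ⟨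
    ∑ m (λ n → f (m ∸ suc n))
      ≡⟨ ∑-reverse m f ⟩
    ∑ m f
      ≡⟨ ∑-cong m (λ i i<m → trans (cong₂ (λ s c → s * c * 1/[1+ i ]) (sign-∸ (ℕ.≤-pred i<m)) (symmetry i<m))
                                     (*-assoc-4 (sign k) (sign i) _ _)) ⟩
    ∑ m (λ i → sign k * (sign i * binomial m (suc i) * 1/[1+ i ]))
      ≡⟨ ∑-*ˡ m (sign k) (λ i → sign i * binomial m (suc i) * 1/[1+ i ]) ⟩
    sign k * ∑ m (λ i → sign i * binomial m (suc i) * 1/[1+ i ])
      ≡⟨ cong (sign k *_) (alternating-binomial-harmonic m) ⟩
    sign k * harmonic m
      ∎
    where
    open ≡-Reasoning
    f : ℕ → ℚ
    f i = signedBinomial (k ∸ i) * 1/[1+ i ]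
    symmetry : ∀ {i} → i < m → binomial m (k ∸ i) ≡ binomial m (suc i)
    symmetry i<m = cong fromℕ (sym (nCk≡nC[n∸k] i<m))
    *-assoc-4 : ∀ a b c d → a * b * c * d ≡ a * (b * c * d)
    *-assoc-4 = solve-∀ ℚ-ring

  ∑term≈-sign*fermatQuotient : ∑ m term ≈ - (sign m * fermatQuotient p (fromℤ (+ 2)))
  ∑term≈-sign*fermatQuotient = begin
    ∑ m term
      ≈⟨ ≈-∑ m (λ n → term≈-½*signedBinomial*1/[1+k-n]) ⟩
    ∑ m (λ n → -½ * (signedBinomial n * 1/[1+ k ∸ n ]))
      ≡⟨ ∑-*ˡ m -½ (λ n → signedBinomial n * 1/[1+ k ∸ n ]) ⟩
    -½ * ∑ m (λ n → signedBinomial n * 1/[1+ k ∸ n ])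
      ≡⟨ cong (-½ *_) ∑-signedBinomial-reversed ⟩
    -½ * (sign k * harmonic m)
      ≡⟨ sign-flip (sign k) (harmonic m) ⟩
    - (sign m * (-½ * harmonic m))
      ≈⟨ ≈-neg (≈-*ˡ (Integral-sign m) fermatQuotient≈-½*harmonic) ⟨
    - (sign m * fermatQuotient p (fromℤ (+ 2)))
      ∎
    where
    open ≈-Reasoning
    sign-flip : ∀ s h → -½ * (s * h) ≡ - ((- 1ℚ * s) * (-½ * h))
    sign-flip = solve-∀ ℚ-ring

[2*n]/2≡n : ∀ n → 2 ℕ.* n / 2 ≡ n
[2*n]/2≡n n = trans (cong (_/ 2) (ℕ.*-comm 2 n)) (m*n/n≡m n 2)

odd-prime : ∀ {p} → Prime p → 2 < p → ∃[ k ] p ≡ suc (2 ℕ.* suc k)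
odd-prime {p} p-prime 2<p = decompose (p % 2) (p / 2) (m≡m%n+[m/n]*n p 2) (m%n<n p 2)
  where
  decompose : ∀ r q → p ≡ r ℕ.+ q ℕ.* 2 → r < 2 → ∃[ k ] p ≡ suc (2 ℕ.* suc k)
  decompose 0 q p≡2q _ with prime⇒irreducible p-prime (divides q p≡2q)
  ... | inj₁ ()
  ... | inj₂ 2≡p = ⊥-elim (ℕ.<-irrefl 2≡p 2<p)
  decompose 1 0       p≡1 _ = ⊥-elim (ℕ.<⇒≱ 2<p (subst (ℕ._≤ 2) (sym p≡1) (ℕ.s≤s ℕ.z≤n)))
  decompose 1 (suc k) p≡1+2q _ = k , trans p≡1+2q (cong suc (ℕ.*-comm (suc k) 2))
  decompose (suc (suc r)) _ _ (ℕ.s≤s (ℕ.s≤s ()))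

lemma2 : (p : ℕ) → .{{_ : NonZero p}} → Prime p → 2 < p →
    sumℚ (Data.Nat.suc ((p ∸ 3) / 2)) term
      ≡ - (((- 1ℚ) ^ℚ ((p ∸ 1) / 2)) * fermatQuotient p ((+ 2) /ℚ 1)) [modℚ p ]
lemma2 p p-prime 2<p with odd-prime p-prime 2<p
... | k , refl =
  subst₂ (λ x y → x ≡ y [modℚ p ]) (sym lhs≡∑) (sym rhs≡) (≈⇒≡[modℚ] ∑term≈-sign*fermatQuotient)
  where
  open ModPrime p p-prime using (≈⇒≡[modℚ])
  open OddPrime k p-prime using (∑term≈-sign*fermatQuotient)
  lhs≡∑ : sumℚ (suc ((p ∸ 3) / 2)) term ≡ ∑ (suc k) term
  lhs≡∑ = trans (cong (λ n → sumℚ (suc n) term) (trans (cong (λ n → (n ∸ 2) / 2) (ℕ.*-suc 2 k)) ([2*n]/2≡n k)))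
               (sumℚ≡∑ (suc k) term)
  rhs≡ : - (((- 1ℚ) ^ℚ ((p ∸ 1) / 2)) * fermatQuotient p ((+ 2) /ℚ 1))
         ≡ - (sign (suc k) * fermatQuotient p (fromℤ (+ 2)))
  rhs≡ = cong₂ (λ e x → - ((- 1ℚ) ^ℚ e * fermatQuotient p x)) ([2*n]/2≡n (suc k)) (sym (fromℤ-unfold (+ 2)))
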